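{- Let $n\ge 1$ and $j\ge 0$. Let $w_1,w_2$ be Catalan half-words of length $n$, each with exactly $j$ ones, such that $\{i : x_ix_{i+1}=01 \text{ in } w_1\}=\{i: x_ix_{i+1}=01 \text{ in } w_2\}$. Let $w_3$ be any Catalan half-word of length $n$ with exactly $j$ ones. Set $w_b=w_1w_3^{ -1}$ and $w_c=w_2w_3^{ -1}$ (concatenation). Then $$\operatorname{maj}(w_b)-\operatorname{maj}(w_b^{ -1}) = \operatorname{maj}(w_c)-\operatorname{maj}(w_c^{ -1}).$$
   Context: A Catalan half-word of length $n$ is a word $x_1\cdots x_n$ with $x_i\in\{0,1\}$ such that no initial segment contains more 1s than 0s. For a $0/1$ word $w=x_1\cdots x_m$, $\mathrm{Des}(w)=\{i : x_i=1,\ x_{i+1}=0\}$ and $\operatorname{maj}(w)=\sum_{i\in\mathrm{Des}(w)} i$. The inverse $w^{ -1}$ of a $0/1$ word is obtained by reversing it and exchanging 0 and 1. Note $(w_1w_3^{ -1})^{ -1}=w_3w_1^{ -1}$. -}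

module Defs where

open import Data.Bool using (Bool; true; false; not)
open import Data.Nat using (ℕ; zero; suc; _+_; _≤_)
open import Data.List using (List; []; _∷_; reverse; map; length; take)
open import Data.Empty using (⊥)
open import Data.Product using (_×_)
open import Relation.Binary.PropositionalEquality using (_≡_)

-- A 0/1 word is a list of booleans: false = 0, true = 1.
Word : Set
Word = List Bool

ones : Word → ℕ
ones [] = 0
ones (true ∷ w) = suc (ones w)
ones (false ∷ w) = ones w

zeros : Word → ℕ
zeros [] = 0
zeros (true ∷ w) = zeros w
zeros (false ∷ w) = suc (zeros w)

CatalanHalf : Word → Set
CatalanHalf w = ∀ k → ones (take k w) ≤ zeros (take k w)

-- letter x_i (1-indexed); positions outside 1..m give nothing
_!_ : Word → ℕ → Bool → Set
[] ! i = λ _ → ⊥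
(x ∷ w) ! zero = λ _ → ⊥
(x ∷ w) ! suc zero = λ b → x ≡ b
(x ∷ w) ! suc (suc i) = w ! suc i

Asc : Word → ℕ → Set
Asc w i = (w ! i) false × (w ! suc i) true

majFrom : ℕ → Word → ℕ
majFrom i [] = 0
majFrom i (x ∷ []) = 0
majFrom i (true ∷ false ∷ w) = i + majFrom (suc i) (false ∷ w)
majFrom i (x ∷ y ∷ w) = majFrom (suc i) (y ∷ w)

maj : Word → ℕ
maj = majFrom 1

inv : Word → Word
inv w = reverse (map not w)

-- Since descents of w⁻¹ sit at the mirrored positions, maj w + maj w⁻¹ = |w| · des w, so
-- maj w − maj w⁻¹ = 2 (maj w − n · des w) when |w| = 2n. For w = u v with |u| = n the
-- quantity maj w − n · des w splits as (maj u − n · des u) + maj v: the junction descent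
-- and the shift of the descents of v cancel. Finally, for u starting with 0, the runs of 1s
-- in u lie between an ascent and the next descent, which gives
-- maj u − n · des u = (sum of ascents of u) + #1s(u) − n · (number of ascents of u),
-- a function of the ascent set of u and its number of 1s alone.
module Submission where

open import Defs
open import Data.Bool using (Bool; true; false; not; _≟_)
open import Data.Nat using (ℕ; zero; suc; _+_; _*_; _≥_)
open import Data.Nat.Properties using (+-identityʳ; +-assoc; +-comm; +-suc; suc-injective; +-cancelʳ-≡)
open import Data.Nat.Tactic.RingSolver using (solve-∀)
open import Data.List using ([]; _∷_; _++_; [_]; length; map)
open import Data.List.Properties using (length-++; length-map; length-reverse; unfold-reverse)
open import Data.Integer using (+_; _-_; _⊖_)
open import Data.Integer.Properties using (m-n≡m⊖n; +-cancelˡ-⊖)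
open import Data.Empty using (⊥-elim)
open import Data.Product using (_×_; _,_; proj₁; proj₂)
open import Function using (_∘_)
open import Relation.Nullary using (¬_; yes; no; contradiction)
open import Relation.Nullary.Decidable using (_×-dec_)
open import Relation.Binary.PropositionalEquality using (_≡_; refl; sym; trans; cong; cong₂; module ≡-Reasoning)

open ≡-Reasoning

bit : Bool → ℕ
bit true  = 1
bit false = 0

descent : Bool → Bool → ℕ
descent true false = 1
descent _    _     = 0

ascent : Bool → Bool → ℕ
ascent false true = 1
ascent _     _    = 0

ones-∷ : ∀ x w → ones (x ∷ w) ≡ bit x + ones w
ones-∷ true  w = refl
ones-∷ false w = refl

descent-not : ∀ x y → descent (not x) (not y) ≡ descent y x
descent-not true  true  = refl
descent-not true  false = refl
descent-not false true  = refl
descent-not false false = refl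

descent+bit≡ascent+bit : ∀ x y → descent x y + bit y ≡ ascent x y + bit x
descent+bit≡ascent+bit true  true  = refl
descent+bit≡ascent+bit true  false = refl
descent+bit≡ascent+bit false true  = refl
descent+bit≡ascent+bit false false = refl

des : Word → ℕ
des (x ∷ y ∷ w) = descent x y + des (y ∷ w)
des _           = 0

asc : Word → ℕ
asc (x ∷ y ∷ w) = ascent x y + asc (y ∷ w)
asc _           = 0

ascMajFrom : ℕ → Word → ℕ
ascMajFrom i (x ∷ y ∷ w) = ascent x y * i + ascMajFrom (suc i) (y ∷ w)
ascMajFrom i _           = 0

headBit : Word → ℕ
headBit []      = 0
headBit (x ∷ _) = bit x

lastBit : Word → ℕ
lastBit []          = 0
lastBit (x ∷ [])    = bit x
lastBit (_ ∷ y ∷ w) = lastBit (y ∷ w)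

junction : Word → Word → ℕ
junction (x ∷ [])    (y ∷ _) = descent x y
junction (_ ∷ y ∷ u) v       = junction (y ∷ u) v
junction _           _       = 0

+-reassoc : ∀ a b c d → a + (b + c + d) ≡ a + b + c + d
+-reassoc = solve-∀

majFrom-∷∷ : ∀ i x y w → majFrom i (x ∷ y ∷ w) ≡ descent x y * i + majFrom (suc i) (y ∷ w)
majFrom-∷∷ i true  false w = cong (_+ majFrom (suc i) (false ∷ w)) (sym (+-identityʳ i))
majFrom-∷∷ i true  true  w = refl
majFrom-∷∷ i false _     w = refl

majFrom-suc : ∀ i w → majFrom (suc i) w ≡ majFrom i w + des w
majFrom-suc i []          = refl
majFrom-suc i (x ∷ [])    = refl
majFrom-suc i (x ∷ y ∷ w) = begin
    majFrom (suc i) (x ∷ y ∷ w)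
  ≡⟨ majFrom-∷∷ (suc i) x y w ⟩
    d * suc i + majFrom (suc (suc i)) (y ∷ w)
  ≡⟨ cong (_+_ (d * suc i)) (majFrom-suc (suc i) (y ∷ w)) ⟩
    d * suc i + (majFrom (suc i) (y ∷ w) + des (y ∷ w))
  ≡⟨ regroup d i _ _ ⟩
    (d * i + majFrom (suc i) (y ∷ w)) + (d + des (y ∷ w))
  ≡⟨ cong (_+ (d + des (y ∷ w))) (majFrom-∷∷ i x y w) ⟨
    majFrom i (x ∷ y ∷ w) + des (x ∷ y ∷ w)
  ∎
  where
  d : ℕ
  d = descent x y
  regroup : ∀ d i m e → d * suc i + (m + e) ≡ (d * i + m) + (d + e)
  regroup = solve-∀

majFrom-shift : ∀ k w → majFrom (suc k) w ≡ maj w + k * des w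
majFrom-shift zero    w = sym (+-identityʳ (maj w))
majFrom-shift (suc k) w = begin
    majFrom (suc (suc k)) w         ≡⟨ majFrom-suc (suc k) w ⟩
    majFrom (suc k) w + des w       ≡⟨ cong (_+ des w) (majFrom-shift k w) ⟩
    maj w + k * des w + des w       ≡⟨ +-assoc (maj w) _ _ ⟩
    maj w + (k * des w + des w)     ≡⟨ cong (_+_ (maj w)) (+-comm (k * des w) (des w)) ⟩
    maj w + suc k * des w           ∎

majFrom-++ : ∀ i u v → majFrom (suc i) (u ++ v)
  ≡ majFrom (suc i) u + junction u v * (length u + i) + majFrom (suc (length u + i)) v
majFrom-++ i []          v       = refl
majFrom-++ i (x ∷ [])    []      = refl
majFrom-++ i (x ∷ [])    (y ∷ v) = majFrom-∷∷ (suc i) x y v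
majFrom-++ i (x ∷ y ∷ u) v       = begin
    majFrom (suc i) (x ∷ y ∷ u ++ v)
  ≡⟨ majFrom-∷∷ (suc i) x y (u ++ v) ⟩
    d * suc i + majFrom (suc (suc i)) (y ∷ u ++ v)
  ≡⟨ cong (_+_ (d * suc i)) (majFrom-++ (suc i) (y ∷ u) v) ⟩
    d * suc i + (majFrom (suc (suc i)) (y ∷ u) + J * (ℓ + suc i) + majFrom (suc (ℓ + suc i)) v)
  ≡⟨ cong (λ k → d * suc i + (majFrom (suc (suc i)) (y ∷ u) + J * k + majFrom (suc k) v)) (+-suc ℓ i) ⟩
    d * suc i + (majFrom (suc (suc i)) (y ∷ u) + J * suc (ℓ + i) + majFrom (suc (suc (ℓ + i))) v)
  ≡⟨ +-reassoc (d * suc i) _ _ _ ⟩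
    d * suc i + majFrom (suc (suc i)) (y ∷ u) + J * suc (ℓ + i) + majFrom (suc (suc (ℓ + i))) v
  ≡⟨ cong (λ m → m + J * suc (ℓ + i) + majFrom (suc (suc (ℓ + i))) v) (majFrom-∷∷ (suc i) x y u) ⟨
    majFrom (suc i) (x ∷ y ∷ u) + J * suc (ℓ + i) + majFrom (suc (suc (ℓ + i))) v
  ∎
  where
  d J ℓ : ℕ
  d = descent x y
  J = junction (y ∷ u) v
  ℓ = length (y ∷ u)

des-++ : ∀ u v → des (u ++ v) ≡ des u + junction u v + des v
des-++ []          v       = refl
des-++ (x ∷ [])    []      = refl
des-++ (x ∷ [])    (y ∷ v) = refl
des-++ (x ∷ y ∷ u) v       =
  trans (cong (_+_ (descent x y)) (des-++ (y ∷ u) v)) (+-reassoc (descent x y) _ _ _)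

-- With |u| = n, the descents of v are shifted by n and the junction descent sits at n,
-- so both are absorbed by n · des (u ++ v).
maj-++ : ∀ u v → maj (u ++ v) + length u * des u ≡ maj u + maj v + length u * des (u ++ v)
maj-++ u v = begin
    maj (u ++ v) + n * des u
  ≡⟨ cong (_+ n * des u) (majFrom-++ 0 u v) ⟩
    maj u + J * (n + 0) + majFrom (suc (n + 0)) v + n * des u
  ≡⟨ cong (λ k → maj u + J * k + majFrom (suc k) v + n * des u) (+-identityʳ n) ⟩
    maj u + J * n + majFrom (suc n) v + n * des u
  ≡⟨ cong (λ m → maj u + J * n + m + n * des u) (majFrom-shift n v) ⟩
    maj u + J * n + (maj v + n * des v) + n * des u
  ≡⟨ regroup (maj u) (maj v) n J (des u) (des v) ⟩
    maj u + maj v + n * (des u + J + des v)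
  ≡⟨ cong (λ t → maj u + maj v + n * t) (des-++ u v) ⟨
    maj u + maj v + n * des (u ++ v)
  ∎
  where
  n J : ℕ
  n = length u
  J = junction u v
  regroup : ∀ mu mv n J du dv → mu + J * n + (mv + n * dv) + n * du ≡ mu + mv + n * (du + J + dv)
  regroup = solve-∀

inv-∷ : ∀ x w → inv (x ∷ w) ≡ inv w ++ [ not x ]
inv-∷ x w = unfold-reverse (not x) (map not w)

length-inv : ∀ w → length (inv w) ≡ length w
length-inv w = trans (length-reverse (map not w)) (length-map not w)

junction-∷ʳ : ∀ u x v → junction (u ++ [ x ]) v ≡ junction [ x ] v
junction-∷ʳ []          x v = refl
junction-∷ʳ (_ ∷ [])    x v = refl
junction-∷ʳ (_ ∷ y ∷ u) x v = junction-∷ʳ (y ∷ u) x v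

maj-∷ʳ : ∀ u x → maj (u ++ [ x ]) ≡ maj u + junction u [ x ] * length u
maj-∷ʳ u x = trans (majFrom-++ 0 u [ x ]) (trans (+-identityʳ _)
  (cong (λ k → maj u + junction u [ x ] * k) (+-identityʳ (length u))))

maj-inv-∷∷ : ∀ x y w → maj (inv (x ∷ y ∷ w)) ≡ maj (inv (y ∷ w)) + descent x y * length (y ∷ w)
maj-inv-∷∷ x y w = begin
    maj (inv (x ∷ y ∷ w))
  ≡⟨ cong maj (inv-∷ x (y ∷ w)) ⟩
    maj (inv (y ∷ w) ++ [ not x ])
  ≡⟨ maj-∷ʳ (inv (y ∷ w)) (not x) ⟩
    maj (inv (y ∷ w)) + junction (inv (y ∷ w)) [ not x ] * length (inv (y ∷ w))
  ≡⟨ cong₂ (λ J ℓ → maj (inv (y ∷ w)) + J * ℓ) last-junction (length-inv (y ∷ w)) ⟩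
    maj (inv (y ∷ w)) + descent x y * length (y ∷ w)
  ∎
  where
  last-junction : junction (inv (y ∷ w)) [ not x ] ≡ descent x y
  last-junction = trans (cong (λ u → junction u [ not x ]) (inv-∷ y w))
    (trans (junction-∷ʳ (inv w) (not y) [ not x ]) (descent-not y x))

maj+maj-inv : ∀ w → maj w + maj (inv w) ≡ length w * des w
maj+maj-inv []          = refl
maj+maj-inv (x ∷ [])    = refl
maj+maj-inv (x ∷ y ∷ w) = begin
    maj (x ∷ y ∷ w) + maj (inv (x ∷ y ∷ w))
  ≡⟨ cong₂ _+_ (trans (majFrom-∷∷ 1 x y w) (cong (_+_ (d * 1)) (majFrom-suc 1 (y ∷ w)))) (maj-inv-∷∷ x y w) ⟩
    (d * 1 + (maj (y ∷ w) + D)) + (maj (inv (y ∷ w)) + d * ℓ)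
  ≡⟨ regroup d (maj (y ∷ w)) (maj (inv (y ∷ w))) D ℓ ⟩
    (maj (y ∷ w) + maj (inv (y ∷ w))) + (d * 1 + D + d * ℓ)
  ≡⟨ cong (_+ (d * 1 + D + d * ℓ)) (maj+maj-inv (y ∷ w)) ⟩
    ℓ * D + (d * 1 + D + d * ℓ)
  ≡⟨ collect d D ℓ ⟩
    suc ℓ * (d + D)
  ∎
  where
  d D ℓ : ℕ
  d = descent x y
  D = des (y ∷ w)
  ℓ = length (y ∷ w)
  regroup : ∀ d m i D ℓ → (d * 1 + (m + D)) + (i + d * ℓ) ≡ (m + i) + (d * 1 + D + d * ℓ)
  regroup = solve-∀
  collect : ∀ d D ℓ → ℓ * D + (d * 1 + D + d * ℓ) ≡ suc ℓ * (d + D)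
  collect = solve-∀

des+lastBit : ∀ w → des w + lastBit w ≡ asc w + headBit w
des+lastBit []          = refl
des+lastBit (x ∷ [])    = refl
des+lastBit (x ∷ y ∷ w) = begin
    descent x y + des (y ∷ w) + lastBit (y ∷ w)
  ≡⟨ +-assoc (descent x y) _ _ ⟩
    descent x y + (des (y ∷ w) + lastBit (y ∷ w))
  ≡⟨ cong (_+_ (descent x y)) (des+lastBit (y ∷ w)) ⟩
    descent x y + (asc (y ∷ w) + bit y)
  ≡⟨ swap (descent x y) _ _ ⟩
    descent x y + bit y + asc (y ∷ w)
  ≡⟨ cong (_+ asc (y ∷ w)) (descent+bit≡ascent+bit x y) ⟩
    ascent x y + bit x + asc (y ∷ w)
  ≡⟨ swap′ (ascent x y) _ _ ⟩
    ascent x y + asc (y ∷ w) + bit x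
  ∎
  where
  swap : ∀ d a b → d + (a + b) ≡ d + b + a
  swap = solve-∀
  swap′ : ∀ a b c → a + b + c ≡ a + c + b
  swap′ = solve-∀

-- Summing (i + k) · (descent − ascent) = (i + k) · (x_k − x_{k+1}) over the positions k
-- of w telescopes to the number of 1s, up to boundary terms.
majFrom+lastBit : ∀ i w → majFrom (suc i) w + lastBit w * (i + length w)
  ≡ i * headBit w + ascMajFrom (suc i) w + ones w
majFrom+lastBit i []          = empty i
  where
  empty : ∀ i → 0 ≡ i * 0 + 0 + 0
  empty = solve-∀
majFrom+lastBit i (x ∷ [])    = trans (single (bit x) i) (sym (cong (_+_ (i * bit x + 0)) (ones-∷ x [])))
  where
  single : ∀ b i → b * (i + 1) ≡ i * b + 0 + (b + 0)
  single = solve-∀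
majFrom+lastBit i (x ∷ y ∷ w) = begin
    majFrom (suc i) (x ∷ y ∷ w) + L * (i + suc ℓ)
  ≡⟨ cong₂ _+_ (majFrom-∷∷ (suc i) x y w) (cong (L *_) (+-suc i ℓ)) ⟩
    d * suc i + majFrom (suc (suc i)) (y ∷ w) + L * (suc i + ℓ)
  ≡⟨ +-assoc (d * suc i) _ _ ⟩
    d * suc i + (majFrom (suc (suc i)) (y ∷ w) + L * (suc i + ℓ))
  ≡⟨ cong (_+_ (d * suc i)) (majFrom+lastBit (suc i) (y ∷ w)) ⟩
    d * suc i + (suc i * bit y + A + O)
  ≡⟨ factor d (bit y) i A O ⟩
    (d + bit y) * suc i + (A + O)
  ≡⟨ cong (λ t → t * suc i + (A + O)) (descent+bit≡ascent+bit x y) ⟩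
    (ascent x y + bit x) * suc i + (A + O)
  ≡⟨ expand (ascent x y) (bit x) i A O ⟩
    i * bit x + (ascent x y * suc i + A) + (bit x + O)
  ≡⟨ cong (_+_ (i * bit x + (ascent x y * suc i + A))) (ones-∷ x (y ∷ w)) ⟨
    i * bit x + ascMajFrom (suc i) (x ∷ y ∷ w) + ones (x ∷ y ∷ w)
  ∎
  where
  d L ℓ A O : ℕ
  d = descent x y
  L = lastBit (y ∷ w)
  ℓ = length (y ∷ w)
  A = ascMajFrom (suc (suc i)) (y ∷ w)
  O = ones (y ∷ w)
  factor : ∀ d b i A O → d * suc i + (suc i * b + A + O) ≡ (d + b) * suc i + (A + O)
  factor = solve-∀
  expand : ∀ a b i A O → (a + b) * suc i + (A + O) ≡ i * b + (a * suc i + A) + (b + O)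
  expand = solve-∀

maj+length*asc : ∀ w → headBit w ≡ 0 →
  maj w + length w * asc w ≡ ascMajFrom 1 w + ones w + length w * des w
maj+length*asc w head0 = begin
    maj w + n * asc w
  ≡⟨ cong (λ a → maj w + n * a) des+lastBit≡asc ⟨
    maj w + n * (des w + lastBit w)
  ≡⟨ regroup (maj w) n (des w) (lastBit w) ⟩
    maj w + lastBit w * n + n * des w
  ≡⟨ cong (_+ n * des w) (majFrom+lastBit 0 w) ⟩
    ascMajFrom 1 w + ones w + n * des w
  ∎
  where
  n : ℕ
  n = length w
  des+lastBit≡asc : des w + lastBit w ≡ asc w
  des+lastBit≡asc = trans (des+lastBit w) (trans (cong (_+_ (asc w)) head0) (+-identityʳ (asc w)))
  regroup : ∀ m n D L → m + n * (D + L) ≡ m + L * n + n * D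
  regroup = solve-∀

catalan⇒headBit≡0 : ∀ w → CatalanHalf w → headBit w ≡ 0
catalan⇒headBit≡0 []          _ = refl
catalan⇒headBit≡0 (false ∷ _) _ = refl
catalan⇒headBit≡0 (true ∷ _)  c with c 1
... | ()

SameAscents : Word → Word → Set
SameAscents w w′ = ∀ i → (Asc w i → Asc w′ i) × (Asc w′ i → Asc w i)

ascent≡1 : ∀ {x y} → x ≡ false × y ≡ true → ascent x y ≡ 1
ascent≡1 (refl , refl) = refl

ascent≡0 : ∀ x y → ¬ (x ≡ false × y ≡ true) → ascent x y ≡ 0
ascent≡0 false true  ¬asc = contradiction (refl , refl) ¬asc
ascent≡0 false false _    = refl
ascent≡0 true  _     _    = refl

sameAscents-head : ∀ {x y w x′ y′ w′} → SameAscents (x ∷ y ∷ w) (x′ ∷ y′ ∷ w′) →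
  ascent x y ≡ ascent x′ y′
sameAscents-head {x} {y} same with (x ≟ false) ×-dec (y ≟ true)
... | yes asc1 = trans (ascent≡1 asc1) (sym (ascent≡1 (proj₁ (same 1) asc1)))
... | no ¬asc1 = trans (ascent≡0 _ _ ¬asc1) (sym (ascent≡0 _ _ (¬asc1 ∘ proj₂ (same 1))))

no-letter-0 : ∀ w {b} → ¬ (w ! 0) b
no-letter-0 []      ()
no-letter-0 (_ ∷ _) ()

sameAscents-∷⁻ : ∀ {x w x′ w′} → SameAscents (x ∷ w) (x′ ∷ w′) → SameAscents w w′
sameAscents-∷⁻ {w = w} {w′ = w′} same zero =
  ⊥-elim ∘ no-letter-0 w ∘ proj₁ , ⊥-elim ∘ no-letter-0 w′ ∘ proj₁
sameAscents-∷⁻ same (suc i) = same (suc (suc i))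

sameAscents⇒asc≡ : ∀ w w′ → length w ≡ length w′ → SameAscents w w′ → asc w ≡ asc w′
sameAscents⇒asc≡ []          []            _ _    = refl
sameAscents⇒asc≡ (_ ∷ [])    (_ ∷ [])      _ _    = refl
sameAscents⇒asc≡ (x ∷ y ∷ w) (x′ ∷ y′ ∷ w′) ℓ same =
  cong₂ _+_ (sameAscents-head same)
    (sameAscents⇒asc≡ (y ∷ w) (y′ ∷ w′) (suc-injective ℓ) (sameAscents-∷⁻ same))
sameAscents⇒asc≡ []          (_ ∷ _)       () _
sameAscents⇒asc≡ (_ ∷ _)     []            () _
sameAscents⇒asc≡ (_ ∷ [])    (_ ∷ _ ∷ _)   () _
sameAscents⇒asc≡ (_ ∷ _ ∷ _) (_ ∷ [])      () _

sameAscents⇒ascMajFrom≡ : ∀ i w w′ → length w ≡ length w′ → SameAscents w w′ →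
  ascMajFrom i w ≡ ascMajFrom i w′
sameAscents⇒ascMajFrom≡ i []          []            _ _    = refl
sameAscents⇒ascMajFrom≡ i (_ ∷ [])    (_ ∷ [])      _ _    = refl
sameAscents⇒ascMajFrom≡ i (x ∷ y ∷ w) (x′ ∷ y′ ∷ w′) ℓ same =
  cong₂ (λ a r → a * i + r) (sameAscents-head same)
    (sameAscents⇒ascMajFrom≡ (suc i) (y ∷ w) (y′ ∷ w′) (suc-injective ℓ) (sameAscents-∷⁻ same))
sameAscents⇒ascMajFrom≡ i []          (_ ∷ _)       () _
sameAscents⇒ascMajFrom≡ i (_ ∷ _)     []            () _
sameAscents⇒ascMajFrom≡ i (_ ∷ [])    (_ ∷ _ ∷ _)   () _
sameAscents⇒ascMajFrom≡ i (_ ∷ _ ∷ _) (_ ∷ [])      () _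

m+o≡n+p⇒m-n≡p-o : ∀ m n o p → m + o ≡ n + p → + m - + n ≡ + p - + o
m+o≡n+p⇒m-n≡p-o m n o p eq = begin
    + m - + n            ≡⟨ m-n≡m⊖n m n ⟩
    m ⊖ n                ≡⟨ +-cancelˡ-⊖ o m n ⟨
    (o + m) ⊖ (o + n)    ≡⟨ cong₂ _⊖_ (trans (+-comm o m) eq) (+-comm o n) ⟩
    (n + p) ⊖ (n + o)    ≡⟨ +-cancelˡ-⊖ n p o ⟩
    p ⊖ o                ≡⟨ m-n≡m⊖n p o ⟨
    + p - + o            ∎

-- M, I, D: maj, maj of the inverse, and des of u v; m, d, a: maj, des, asc of u;
-- s = (sum of ascents of u) + #1s(u); V = maj v.
maj-difference-arithmetic : ∀ n M I D m d a s V →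
  M + I ≡ (n + n) * D → M + n * d ≡ m + V + n * D → m + n * a ≡ s + n * d →
  M + (n + n) * a ≡ I + 2 * (s + V)
maj-difference-arithmetic n M I D m d a s V inverse concat ascents =
  +-cancelʳ-≡ (M + (n + n) * d) _ _ (begin
    M + (n + n) * a + (M + (n + n) * d)
  ≡⟨ step₁ n M d a ⟩
    2 * (M + n * d) + (n + n) * a
  ≡⟨ cong (λ t → 2 * t + (n + n) * a) concat ⟩
    2 * (m + V + n * D) + (n + n) * a
  ≡⟨ step₂ n m V D a ⟩
    2 * (m + n * a) + 2 * V + (n + n) * D
  ≡⟨ cong (λ t → 2 * t + 2 * V + (n + n) * D) ascents ⟩
    2 * (s + n * d) + 2 * V + (n + n) * D
  ≡⟨ cong (_+_ (2 * (s + n * d) + 2 * V)) inverse ⟨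
    2 * (s + n * d) + 2 * V + (M + I)
  ≡⟨ step₃ n M I d s V ⟩
    I + 2 * (s + V) + (M + (n + n) * d)
  ∎)
  where
  step₁ : ∀ n M d a → M + (n + n) * a + (M + (n + n) * d) ≡ 2 * (M + n * d) + (n + n) * a
  step₁ = solve-∀
  step₂ : ∀ n m V D a → 2 * (m + V + n * D) + (n + n) * a ≡ 2 * (m + n * a) + 2 * V + (n + n) * D
  step₂ = solve-∀
  step₃ : ∀ n M I d s V → 2 * (s + n * d) + 2 * V + (M + I) ≡ I + 2 * (s + V) + (M + (n + n) * d)
  step₃ = solve-∀

maj-difference : ∀ {n} u v → length u ≡ n → length v ≡ n → headBit u ≡ 0 →
  (+ maj (u ++ v)) - (+ maj (inv (u ++ v)))
    ≡ (+ (2 * (ascMajFrom 1 u + ones u + maj v))) - (+ ((n + n) * asc u))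
maj-difference u v refl |v| head0 =
  m+o≡n+p⇒m-n≡p-o (maj (u ++ v)) (maj (inv (u ++ v))) ((n + n) * asc u) (2 * (ascMajFrom 1 u + ones u + maj v))
    (maj-difference-arithmetic n (maj (u ++ v)) (maj (inv (u ++ v))) (des (u ++ v)) (maj u) (des u)
      (asc u) (ascMajFrom 1 u + ones u) (maj v) inverse (maj-++ u v) (maj+length*asc u head0))
  where
  n : ℕ
  n = length u
  inverse : maj (u ++ v) + maj (inv (u ++ v)) ≡ (length u + length u) * des (u ++ v)
  inverse = trans (maj+maj-inv (u ++ v))
    (cong (_* des (u ++ v)) (trans (length-++ u) (cong (_+_ (length u)) |v|)))

lemma2 : (n j : ℕ) → n ≥ 1 → (w₁ w₂ w₃ : Word) →
    length w₁ ≡ n → CatalanHalf w₁ → ones w₁ ≡ j →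
    length w₂ ≡ n → CatalanHalf w₂ → ones w₂ ≡ j →
    length w₃ ≡ n → CatalanHalf w₃ → ones w₃ ≡ j →
    (∀ i → (Asc w₁ i → Asc w₂ i) × (Asc w₂ i → Asc w₁ i)) →
    (+ maj (w₁ ++ inv w₃)) - (+ maj (inv (w₁ ++ inv w₃)))
      ≡ (+ maj (w₂ ++ inv w₃)) - (+ maj (inv (w₂ ++ inv w₃)))
lemma2 n j _ w₁ w₂ w₃ |w₁| c₁ o₁ |w₂| c₂ o₂ |w₃| _ _ same = begin
    (+ maj (w₁ ++ v)) - (+ maj (inv (w₁ ++ v)))
  ≡⟨ maj-difference w₁ v |w₁| |v| (catalan⇒headBit≡0 w₁ c₁) ⟩
    (+ (2 * (ascMajFrom 1 w₁ + ones w₁ + maj v))) - (+ ((n + n) * asc w₁))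
  ≡⟨ cong₂ (λ s a → (+ (2 * (s + maj v))) - (+ ((n + n) * a)))
       (cong₂ _+_ (sameAscents⇒ascMajFrom≡ 1 w₁ w₂ |w₁|≡|w₂| same) (trans o₁ (sym o₂)))
       (sameAscents⇒asc≡ w₁ w₂ |w₁|≡|w₂| same) ⟩
    (+ (2 * (ascMajFrom 1 w₂ + ones w₂ + maj v))) - (+ ((n + n) * asc w₂))
  ≡⟨ maj-difference w₂ v |w₂| |v| (catalan⇒headBit≡0 w₂ c₂) ⟨
    (+ maj (w₂ ++ v)) - (+ maj (inv (w₂ ++ v)))
  ∎
  where
  v : Word
  v = inv w₃
  |v| : length v ≡ n
  |v| = trans (length-inv w₃) |w₃|
  |w₁|≡|w₂| : length w₁ ≡ length w₂
  |w₁|≡|w₂| = trans |w₁| (sym |w₂|)
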